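{- Let $f(x) = 1 + h_1x + h_2x^2 + \cdots$ be the unique power series with all $h_n \in \{1,2\}$ ($n \ge 1$) that is the square of an element of $R$, and let $g(x) = \sum_{n\ge0} g_n x^n$ with $g_n \in \{0,1\}$ be obtained by reducing the coefficients of $f^{1/2} \in R$ modulo $2$. Then $g(0) = 1$ and $$g(x^2) + g(x)^2 \equiv \frac{2}{1-x} \pmod{4}.$$
   Context: $R := 1 + x\mathbb{Z}[[x]]$ is the set of formal power series with integer coefficients and constant term $1$. Congruences of power series mod an integer are coefficientwise; $\frac{2}{1-x} = \sum_{n \ge 0} 2x^n$. -}

module Defs where

open import Data.Nat using (ℕ; zero; suc; _∸_)
open import Data.Integer using (ℤ; +_; _+_; _*_; _-_; 0ℤ)
open import Data.Integer.DivMod using (_%ℕ_)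
open import Data.Integer.Divisibility using (_∣_)

PS : Set
PS = ℕ → ℤ

convSum : PS → PS → ℕ → ℕ → ℤ
convSum a b n zero    = 0ℤ
convSum a b n (suc k) = convSum a b n k + a k * b (n ∸ k)

_⊛_ : PS → PS → PS
(a ⊛ b) n = convSum a b n (suc n)

_⊕_ : PS → PS → PS
(a ⊕ b) n = a n + b n

-- substitution x ↦ x^2 : coefficient n of a(x^2) is a(n/2) if n even, else 0
sub2 : PS → PS
sub2 a zero          = a zero
sub2 a (suc zero)    = 0ℤ
sub2 a (suc (suc n)) = sub2 (λ m → a (suc m)) n

red2 : PS → PS
red2 a n = + (a n %ℕ 2)

twoOverOneMinusX : PS
twoOverOneMinusX n = + 2

_≡PS_[mod_] : PS → PS → ℕ → Set
a ≡PS b [mod m ] = ∀ n → (+ m) ∣ (a n - b n)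

-- Write s = g + 2d with g = red2 s. Then f = s² ≡ g² (mod 4), and g² ≡ g(x²) (mod 2) because
-- squaring is additive mod 2 (Frobenius). At each coefficient n put u = g(x²)ₙ ∈ {0,1},
-- G = (g²)ₙ and F = fₙ ∈ {1,2}: then F ≡ G (mod 4) and G ≡ u (mod 2), so F ≡ u (mod 2),
-- which leaves only u + F = 2; hence u + G ≡ u + F = 2 (mod 4).
module Submission where

open import Defs
open import Data.Nat using (zero; suc; _∸_; _≤_; s≤s; NonZero)
open import Data.Nat.Properties using (≤-refl; m≤n⇒m≤1+n; n∸n≡0; +-∸-assoc)
open import Data.Nat.Divisibility using (∣1⇒≡1)
open import Data.Integer using (ℤ; +_; 0ℤ; 1ℤ; _+_; _-_; _*_; -_)
open import Data.Integer.Properties using (+-identityˡ; +-identityʳ; +-assoc; +-comm)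
open import Data.Integer.DivMod using (_%ℕ_; _/ℕ_; n%ℕd<d; a≡a%ℕn+[a/ℕn]*n)
open import Data.Integer.Divisibility.Signed
  using (_∣_; divides; ∣⇒∣ᵤ; ∣-trans; ∣m∣n⇒∣m+n; ∣m⇒∣-m; ∣n⇒∣m*n; ∣m⇒∣m*n; *-monoʳ-∣; *-monoˡ-∣)
open import Data.Integer.Tactic.RingSolver using (solve-∀)
open import Data.Sum using (_⊎_; inj₁; inj₂) renaming (map to ⊎-map)
open import Data.Product using (_×_; _,_)
open import Function using (_∘_)
open import Relation.Binary.PropositionalEquality
  using (_≡_; refl; sym; trans; cong; cong₂; subst; module ≡-Reasoning)
open import Relation.Nullary using (¬_; contradiction)
open import Relation.Unary using (Pred)

n%ℕ2≡0⊎n%ℕ2≡1 : ∀ n → n %ℕ 2 ≡ 0 ⊎ n %ℕ 2 ≡ 1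
n%ℕ2≡0⊎n%ℕ2≡1 n with n %ℕ 2 | n%ℕd<d n 2
... | 0           | _               = inj₁ refl
... | 1           | _               = inj₂ refl
... | suc (suc _) | s≤s (s≤s ())

d∣n-n%ℕd : ∀ n d .{{_ : NonZero d}} → + d ∣ n - + (n %ℕ d)
d∣n-n%ℕd n d = divides (n /ℕ d) (begin
    n - + (n %ℕ d)                              ≡⟨ cong (_- + (n %ℕ d)) (a≡a%ℕn+[a/ℕn]*n n d) ⟩
    (+ (n %ℕ d) + (n /ℕ d) * + d) - + (n %ℕ d)  ≡⟨ cancel (+ (n %ℕ d)) ((n /ℕ d) * + d) ⟩
    (n /ℕ d) * + d                              ∎)
  where
  open ≡-Reasoning
  cancel : ∀ r q → (r + q) - r ≡ q
  cancel = solve-∀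

2∤1 : ¬ (+ 2 ∣ + 1)
2∤1 2∣1 with ∣1⇒≡1 (∣⇒∣ᵤ 2∣1)
... | ()

2∣n*n-n : ∀ n → + 2 ∣ n * n - n
2∣n*n-n n = subst (+ 2 ∣_) (factor n) (by-parity (n%ℕ2≡0⊎n%ℕ2≡1 n))
  where
  factor : ∀ n → n * (n - 1ℤ) ≡ n * n - n
  factor = solve-∀
  2∣n-r : ∀ {r} → n %ℕ 2 ≡ r → + 2 ∣ n - + r
  2∣n-r n%2≡r = subst (λ r → + 2 ∣ n - + r) n%2≡r (d∣n-n%ℕd n 2)
  by-parity : n %ℕ 2 ≡ 0 ⊎ n %ℕ 2 ≡ 1 → + 2 ∣ n * (n - 1ℤ)
  by-parity (inj₁ even) = ∣m⇒∣m*n (n - 1ℤ) (subst (+ 2 ∣_) (+-identityʳ n) (2∣n-r even))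
  by-parity (inj₂ odd)  = ∣n⇒∣m*n n (2∣n-r odd)

2∣m*n+n*m : ∀ m n → + 2 ∣ m * n + n * m
2∣m*n+n*m m n = divides (m * n) (double m n)
  where
  double : ∀ m n → m * n + n * m ≡ (m * n) * + 2
  double = solve-∀

∣-+-cong : ∀ {k} a b c d → k ∣ a - b → k ∣ c - d → k ∣ (a + c) - (b + d)
∣-+-cong a b c d k∣a-b k∣c-d =
  subst (_ ∣_) (regroup a b c d) (∣m∣n⇒∣m+n k∣a-b k∣c-d)
  where
  regroup : ∀ a b c d → (a - b) + (c - d) ≡ (a + c) - (b + d)
  regroup = solve-∀

square-cong : ∀ {k} m n → + 2 ∣ k → k ∣ m - n → k * + 2 ∣ m * m - n * n
square-cong {k} m n 2∣k k∣m-n =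
  subst (k * + 2 ∣_) (difference-of-squares m n)
    (∣-trans (*-monoʳ-∣ k 2∣m+n) (*-monoˡ-∣ (m + n) k∣m-n))
  where
  difference-of-squares : ∀ m n → (m - n) * (m + n) ≡ m * m - n * n
  difference-of-squares = solve-∀
  sum-via-difference : ∀ m n → (m - n) + n * + 2 ≡ m + n
  sum-via-difference = solve-∀
  2∣m+n : + 2 ∣ m + n
  2∣m+n = subst (+ 2 ∣_) (sum-via-difference m n)
            (∣m∣n⇒∣m+n (∣-trans 2∣k k∣m-n) (∣n⇒∣m*n n (divides 1ℤ refl)))

double-product-cong : ∀ {k} m m′ n n′ → k ∣ m - m′ → k ∣ n - n′ →
                      k * + 2 ∣ (m * n + n * m) - (m′ * n′ + n′ * m′)
double-product-cong {k} m m′ n n′ k∣m-m′ k∣n-n′ =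
  subst (k * + 2 ∣_) (expand m m′ n n′)
    (*-monoˡ-∣ (+ 2) (∣m∣n⇒∣m+n (∣n⇒∣m*n m k∣n-n′) (∣m⇒∣m*n n′ k∣m-m′)))
  where
  expand : ∀ m m′ n n′ → (m * (n - n′) + (m - m′) * n′) * + 2 ≡ (m * n + n * m) - (m′ * n′ + n′ * m′)
  expand = solve-∀

Bit : ℤ → Set
Bit x = x ≡ 0ℤ ⊎ x ≡ 1ℤ

bit+range≡2 : ∀ {u F} → Bit u → F ≡ + 1 ⊎ F ≡ + 2 → + 2 ∣ F - u → u + F ≡ + 2
bit+range≡2 (inj₁ refl) (inj₁ refl) 2∣1 = contradiction 2∣1 2∤1
bit+range≡2 (inj₁ refl) (inj₂ refl) _   = refl
bit+range≡2 (inj₂ refl) (inj₁ refl) _   = refl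
bit+range≡2 (inj₂ refl) (inj₂ refl) 2∣1 = contradiction 2∣1 2∤1

u+G≡2-mod4 : ∀ {u G F} → Bit u → F ≡ + 1 ⊎ F ≡ + 2 → + 4 ∣ F - G → + 2 ∣ G - u → + 4 ∣ (u + G) - + 2
u+G≡2-mod4 {u} {G} {F} u-bit F-range 4∣F-G 2∣G-u = subst (+ 4 ∣_) (begin
    - (F - G)          ≡⟨ negated-difference u G F ⟩
    (u + G) - (u + F)  ≡⟨ cong (λ c → (u + G) - c) u+F≡2 ⟩
    (u + G) - + 2      ∎) (∣m⇒∣-m 4∣F-G)
  where
  open ≡-Reasoning
  negated-difference : ∀ u G F → - (F - G) ≡ (u + G) - (u + F)
  negated-difference = solve-∀
  telescope : ∀ F G u → (F - G) + (G - u) ≡ F - u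
  telescope = solve-∀
  2∣F-u : + 2 ∣ F - u
  2∣F-u = subst (+ 2 ∣_) (telescope F G u) (∣m∣n⇒∣m+n (∣-trans (divides (+ 2) refl) 4∣F-G) 2∣G-u)
  u+F≡2 : u + F ≡ + 2
  u+F≡2 = bit+range≡2 u-bit F-range 2∣F-u

red2-bit : ∀ a i → Bit (red2 a i)
red2-bit a i = ⊎-map (cong (+_)) (cong (+_)) (n%ℕ2≡0⊎n%ℕ2≡1 (a i))

sub2-preserves : ∀ {p} (P : Pred ℤ p) {a} → P 0ℤ → (∀ i → P (a i)) → ∀ n → P (sub2 a n)
sub2-preserves P P0 Pa zero          = Pa 0
sub2-preserves P P0 Pa (suc zero)    = P0
sub2-preserves P P0 Pa (suc (suc n)) = sub2-preserves P P0 (Pa ∘ suc) n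

shift : PS → PS
shift a n = a (suc n)

convSum-shiftˡ : ∀ a b n k → convSum a b (suc n) (suc k) ≡ a 0 * b (suc n) + convSum (shift a) b n k
convSum-shiftˡ a b n zero    = +-comm 0ℤ (a 0 * b (suc n))
convSum-shiftˡ a b n (suc k) = begin
    convSum a b (suc n) (suc k) + a (suc k) * b (n ∸ k)
      ≡⟨ cong (_+ a (suc k) * b (n ∸ k)) (convSum-shiftˡ a b n k) ⟩
    (a 0 * b (suc n) + convSum (shift a) b n k) + a (suc k) * b (n ∸ k)
      ≡⟨ +-assoc (a 0 * b (suc n)) _ _ ⟩
    a 0 * b (suc n) + convSum (shift a) b n (suc k)
      ∎
  where open ≡-Reasoning

convSum-shiftʳ : ∀ a b {n k} → k ≤ suc n → convSum a (shift b) n k ≡ convSum a b (suc n) k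
convSum-shiftʳ a b {k = zero}  _             = refl
convSum-shiftʳ a b {k = suc k} (s≤s k≤n) =
  cong₂ _+_ (convSum-shiftʳ a b (m≤n⇒m≤1+n k≤n)) (cong (λ j → a k * b j) (sym (+-∸-assoc 1 k≤n)))

⊛-zero : ∀ a b → (a ⊛ b) 0 ≡ a 0 * b 0
⊛-zero a b = +-identityˡ (a 0 * b 0)

⊛-one : ∀ a b → (a ⊛ b) 1 ≡ a 0 * b 1 + a 1 * b 0
⊛-one a b = cong (_+ a 1 * b 0) (+-identityˡ (a 0 * b 1))

⊛-peel : ∀ a b n → (a ⊛ b) (suc (suc n)) ≡
         (a 0 * b (suc (suc n)) + a (suc (suc n)) * b 0) + (shift a ⊛ shift b) n
⊛-peel a b n = begin
    (a ⊛ b) (suc (suc n))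
      ≡⟨ cong₂ _+_ (convSum-shiftˡ a b (suc n) (suc n)) (cong (λ j → a (suc (suc n)) * b j) (n∸n≡0 n)) ⟩
    (a 0 * b (suc (suc n)) + convSum (shift a) b (suc n) (suc n)) + a (suc (suc n)) * b 0
      ≡⟨ cong (λ c → (a 0 * b (suc (suc n)) + c) + a (suc (suc n)) * b 0)
              (sym (convSum-shiftʳ (shift a) b {n} ≤-refl)) ⟩
    (a 0 * b (suc (suc n)) + (shift a ⊛ shift b) n) + a (suc (suc n)) * b 0
      ≡⟨ swap (a 0 * b (suc (suc n))) _ _ ⟩
    (a 0 * b (suc (suc n)) + a (suc (suc n)) * b 0) + (shift a ⊛ shift b) n
      ∎
  where
  open ≡-Reasoning
  swap : ∀ x y z → (x + y) + z ≡ (x + z) + y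
  swap = solve-∀

⊛-square≡sub2-mod2 : ∀ a n → + 2 ∣ (a ⊛ a) n - sub2 a n
⊛-square≡sub2-mod2 a zero =
  subst (λ c → + 2 ∣ c - a 0) (sym (⊛-zero a a)) (2∣n*n-n (a 0))
⊛-square≡sub2-mod2 a (suc zero) =
  subst (+ 2 ∣_) (sym (trans (+-identityʳ ((a ⊛ a) 1)) (⊛-one a a))) (2∣m*n+n*m (a 0) (a 1))
⊛-square≡sub2-mod2 a (suc (suc n)) =
  subst (λ c → + 2 ∣ c - sub2 (shift a) n) (sym (⊛-peel a a n))
    (subst (+ 2 ∣_) (sym (+-assoc (a 0 * a (suc (suc n)) + a (suc (suc n)) * a 0) _ _))
      (∣m∣n⇒∣m+n (2∣m*n+n*m (a 0) (a (suc (suc n)))) (⊛-square≡sub2-mod2 (shift a) n)))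

⊛-square-cong : ∀ {k a b} → + 2 ∣ k → (∀ i → k ∣ a i - b i) → ∀ n → k * + 2 ∣ (a ⊛ a) n - (b ⊛ b) n
⊛-square-cong {k} {a} {b} 2∣k k∣a-b zero =
  subst (k * + 2 ∣_) (sym (cong₂ _-_ (⊛-zero a a) (⊛-zero b b)))
    (square-cong (a 0) (b 0) 2∣k (k∣a-b 0))
⊛-square-cong {k} {a} {b} 2∣k k∣a-b (suc zero) =
  subst (k * + 2 ∣_) (sym (cong₂ _-_ (⊛-one a a) (⊛-one b b)))
    (double-product-cong (a 0) (b 0) (a 1) (b 1) (k∣a-b 0) (k∣a-b 1))
⊛-square-cong {k} {a} {b} 2∣k k∣a-b (suc (suc n)) =
  subst (k * + 2 ∣_) (sym (cong₂ _-_ (⊛-peel a a n) (⊛-peel b b n)))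
    (∣-+-cong (ends a) (ends b) ((shift a ⊛ shift a) n) ((shift b ⊛ shift b) n)
      (double-product-cong (a 0) (b 0) (a (suc (suc n))) (b (suc (suc n))) (k∣a-b 0) (k∣a-b (suc (suc n))))
      (⊛-square-cong 2∣k (k∣a-b ∘ suc) n))
  where
  ends : PS → ℤ
  ends c = c 0 * c (suc (suc n)) + c (suc (suc n)) * c 0

theorem20 : (f s : PS) →
    f 0 ≡ + 1 →
    (∀ n → f (suc n) ≡ + 1 ⊎ f (suc n) ≡ + 2) →
    s 0 ≡ + 1 →
    (∀ n → (s ⊛ s) n ≡ f n) →
    red2 s 0 ≡ + 1
      × (sub2 (red2 s) ⊕ (red2 s ⊛ red2 s)) ≡PS twoOverOneMinusX [mod 4 ]
theorem20 f s f₀≡1 fₙ₊₁∈12 s₀≡1 s²≡f = cong (λ c → + (c %ℕ 2)) s₀≡1 , coefficientwise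
  where
  g : PS
  g = red2 s
  fₙ∈12 : ∀ n → f n ≡ + 1 ⊎ f n ≡ + 2
  fₙ∈12 zero    = inj₁ f₀≡1
  fₙ∈12 (suc n) = fₙ₊₁∈12 n
  f≡g²-mod4 : ∀ n → + 4 ∣ f n - (g ⊛ g) n
  f≡g²-mod4 n = subst (λ c → + 4 ∣ c - (g ⊛ g) n) (s²≡f n)
                  (⊛-square-cong (divides 1ℤ refl) (λ i → d∣n-n%ℕd (s i) 2) n)
  coefficientwise : (sub2 g ⊕ (g ⊛ g)) ≡PS twoOverOneMinusX [mod 4 ]
  coefficientwise n = ∣⇒∣ᵤ (u+G≡2-mod4 (sub2-preserves Bit (inj₁ refl) (red2-bit s) n) (fₙ∈12 n)
                                       (f≡g²-mod4 n) (⊛-square≡sub2-mod2 g n))
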